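{- Let $\mathcal{M}$ be a Minsky machine satisfying the standing assumptions below. If $m\ge3$ and $R\le\mathbb{A}(\mathcal{M})^m$ fails to be computational or is halting, then $\mathrm{Rel}_{\le m-1}(\mathbb{A}(\mathcal{M}))\models R$, i.e. every finitary operation on $A(\mathcal{M})$ that preserves all relations of $\mathbb{A}(\mathcal{M})$ of arity at most $m-1$ also preserves $R$.
   Context: Minsky machines. A Minsky machine $\mathcal{M}$ has states $\{0,1,\dots,N\}$ ($0$ is the halting state, $1$ the initial state), two registers $A,B$ holding values in $\mathbb{N}$, and a finite set of instructions of the forms $(i,R,j)$ and $(i,R,k,j)$ with $R\in\{A,B\}$. It acts on configurations $(s,\alpha,\beta)\in\{0,\dots,N\}\times\mathbb{N}\times\mathbb{N}$: $\mathcal{M}(i,\alpha,\beta)$ is $(j,\alpha+1,\beta)$ if $(i,A,j)\in\mathcal{M}$; $(j,\alpha,\beta+1)$ if $(i,B,j)\in\mathcal{M}$; $(j,\alpha-1,\beta)$ if $(i,A,k,j)\in\mathcal{M}$ and $\alpha\neq0$; $(j,\alpha,\beta-1)$ if $(i,B,k,j)\in\mathcal{M}$ and $\beta\ne 0$; $(k,\alpha,\beta)$ if $(i,A,k,j)\in\mathcal{M}$ and $\alpha=0$, or $(i,B,k,j)\in\mathcal{M}$ and $\beta=0$; and $(0,\alpha,\beta)$ if $i=0$. $\mathcal{M}$ halts if $\mathcal{M}^n(1,0,0)$ has state $0$ for some $n$. Standing assumptions on $\mathcal{M}$: it returns both registers to $0$ before halting; it has exactly one instruction $(i,\dots)$ for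 each non-halting state $i$; the instruction for state $1$ has the form $(1,R,s)$; in the state graph (vertices the states, an edge $i\to j$ iff $\mathcal{M}(i,\alpha,\beta)=(j,\alpha',\beta')$ for some $\alpha,\beta,\alpha',\beta'$) every state is reachable from $1$ and $0$ is reachable from every state; and $\mathcal{M}$ halts with capacity $\kappa$ (i.e. it halts and $\alpha+\beta\le\kappa$ whenever $\mathcal{M}^n(1,0,0)=(i,\alpha,\beta)$). The algebra. $A(\mathcal{M})=\{\langle i,c\rangle: 0\le i\le N,\ c\in\{\bullet,\times,0,A,B\}\}$. Put $X=\{\langle i,\times\rangle\}$, $D=\{\langle i,\bullet\rangle\}$, $C=A(\mathcal{M})\setminus(X\cup D)$; $\mathrm{X}(\langle i,c\rangle)=\langle i,\times\rangle$, $\mathrm{State}(\langle i,c\rangle)=i$, $\mathrm{Content}(\langle i,c\rangle)=c$. Write "$(i,R,\dots,j)\in\mathcal{M}$" to mean $(i,R,j)\in\mathcal{M}$ or $(i,R,k,j)\in\mathcal{M}$ for some $k$. The operations (cases read in order, first applicable case applies): $\langle i,c\rangle\wedge\langle j,d\rangle$ is $\langle i,c\rangle$ if the two are equal, else $\langle\min(i,j),\times\rangle$. $M(x,y)$: $\langle j,R\rangle$ if $x=\langle i,\bullet\rangle, y=\langle i,0\rangle,(i,R,j)\in\mathcal{M}$; $\langle j,0\rangle$ if $x=\langle i,\bullet\rangle,y=\langle i,R\rangle,(i,R,k,j)\in\mathcal{M}$; $\langle j,\bullet\rangle$ if $x=\langle i,0\rangle,y=\langle i,\bullet\rangle,(i,R,j)\in\mathcal{M}$;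 $\langle j,\bullet\rangle$ if $x=\langle i,R\rangle,y=\langle i,\bullet\rangle,(i,R,k,j)\in\mathcal{M}$; $\langle j,c\rangle$ if $x=y=\langle i,c\rangle$, $c\ne\bullet$, $(i,R,\dots,j)\in\mathcal{M}$; $\langle j,\times\rangle$ if $\mathrm{State}(x)=\mathrm{State}(y)=i$ and $(i,R,\dots,j)\in\mathcal{M}$; otherwise $\mathrm{X}(y)$. $M'(x)$: $\langle k,c\rangle$ if $x=\langle i,c\rangle$, $(i,R,k,j)\in\mathcal{M}$, $c\neq R$; $\langle k,\times\rangle$ if $\mathrm{State}(x)=i$ and $(i,R,k,j)\in\mathcal{M}$; otherwise $\mathrm{X}(x)$. $I(x,y)$: $\langle1,\bullet\rangle$ if $x\in D$; $\langle 1,0\rangle$ if $y\in C$; otherwise $\langle1,\times\rangle$. $H(x)$: $\langle0,0\rangle$ if $x\in\{\langle0,0\rangle,\langle0,\bullet\rangle\}$, otherwise $\langle0,\times\rangle$. $N_0(x,y,z)$: $y$ if $x=\langle0,\bullet\rangle$ and $\mathrm{State}(y)=\mathrm{State}(z)$; $z$ if $x=\langle0,0\rangle$, $z\notin D$, $\mathrm{State}(y)=\mathrm{State}(z)$; otherwise $\mathrm{X}(y\wedge z)$. $S(x,y,z)$: $\langle1,0\rangle$ if $x=\langle1,0\rangle$, $\mathrm{State}(y)=\mathrm{State}(z)=1$ and $(\mathrm{Content}(y),\mathrm{Content}(z))\in\{(\bullet,0),(0,\bullet),(0,0)\}$; otherwise $\langle1,\times\rangle$. $N_\bullet(u,x,y,z)$,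 where the first four cases require $\mathrm{State}(x)=\mathrm{State}(y)=\mathrm{State}(z)$: $x$ if $x=y\notin X$; $x$ if $u\in D$, $y\in X$; $y$ if $u\in D$, $x\in X$; $z$ if $u\in D$, $z\in\{x,y\}$; otherwise $\mathrm{X}(x\wedge y\wedge z)$. $P(u,v,x,y)$: $x$ if $\mathrm{State}(u)=\mathrm{State}(v)$, else $y$. $\mathbb{A}(\mathcal{M})=\langle A(\mathcal{M});\wedge,M,M',I,H,N_0,S,N_\bullet,P\rangle$; operations act coordinatewise on powers; $R\le\mathbb{A}(\mathcal{M})^m$ means $R$ is a (nonempty) subuniverse of $A(\mathcal{M})^m$ (a relation of arity $m$). Relation notions. $s\in A(\mathcal{M})^m$ is synchronized if $\mathrm{State}(s(i))$ is constant in $i$. $R$ is computational if all its elements are synchronized and each $r\in R$ has at most one coordinate in $D$. $R$ is halting if it contains some $r\in\{\langle0,0\rangle,\langle0,\bullet\rangle\}^m\setminus\{\langle0,0\rangle\}^m$. Standing assumption: the subalgebra of $\mathbb{A}(\mathcal{M})$ generated by $\{\langle1,\bullet\rangle,\langle1,0\rangle\}$ contains $\langle0,\bullet\rangle$. -}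

module Defs where

open import Data.Nat using (ℕ; zero; suc; _+_; _≤_; _≤ᵇ_)
open import Data.Fin using (Fin; zero; suc; toℕ)
open import Data.Fin.Properties using (_≟_)
open import Data.Bool using (Bool; true; false; _∧_; _∨_; not; if_then_else_)
open import Data.Maybe using (Maybe; just; nothing)
open import Data.Product using (Σ; ∃; _×_; _,_; proj₁; proj₂)
open import Data.Sum using (_⊎_)
open import Data.Vec using (Vec; lookup; tabulate)
open import Data.Vec.Relation.Unary.All using (All)
open import Relation.Nullary using (¬_)
open import Relation.Nullary.Decidable using (⌊_⌋)
open import Relation.Binary.PropositionalEquality using (_≡_)
open import Relation.Binary.Construct.Closure.ReflexiveTransitive using (Star)

data Reg : Set where
  RA RB : Reg

-- An instruction for a state i, with targets among the states Fin S:
--   inc R j   is (i,R,j)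
--   dec R k j is (i,R,k,j)
data Instr (S : ℕ) : Set where
  inc : Reg → Fin S → Instr S
  dec : Reg → Fin S → Fin S → Instr S

-- A Minsky machine with states {0,...,N}, N = suc n (so state 1 exists).
-- Exactly one instruction for each non-halting state (suc i): prog i.
record Minsky (n : ℕ) : Set where
  field
    prog : Fin (suc n) → Instr (suc (suc n))

module Machine {n : ℕ} (𝓜 : Minsky n) where
  open Minsky 𝓜

  State : Set
  State = Fin (suc (suc n))

  one : State
  one = suc zero

  instrAt : State → Maybe (Instr (suc (suc n)))
  instrAt zero    = nothing
  instrAt (suc i) = just (prog i)

  Config : Set
  Config = State × ℕ × ℕ

  step : Config → Config
  step (zero , a , b) = (zero , a , b)
  step (suc i , a , b) with prog i
  ... | inc RA j = (j , suc a , b)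
  ... | inc RB j = (j , a , suc b)
  ... | dec RA k j with a
  ...   | zero   = (k , zero , b)
  ...   | suc a' = (j , a' , b)
  step (suc i , a , b) | dec RB k j with b
  ...   | zero   = (k , a , zero)
  ...   | suc b' = (j , a , b')

  run : ℕ → Config
  run zero    = (one , 0 , 0)
  run (suc t) = step (run t)

  Halts : Set
  Halts = ∃ λ t → proj₁ (run t) ≡ zero

  HaltsWithCapacity : ℕ → Set
  HaltsWithCapacity κ =
    Halts × (∀ t → proj₁ (proj₂ (run t)) + proj₂ (proj₂ (run t)) ≤ κ)

  ReturnsRegistersToZero : Set
  ReturnsRegistersToZero =
    ∀ t → proj₁ (run t) ≡ zero →
      (proj₁ (proj₂ (run t)) ≡ 0) × (proj₂ (proj₂ (run t)) ≡ 0)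

  FirstIsInc : Set
  FirstIsInc = Σ Reg λ R → Σ State λ s → prog zero ≡ inc R s

  Edge : State → State → Set
  Edge i j = ∃ λ α → ∃ λ β → ∃ λ α' → ∃ λ β' → step (i , α , β) ≡ (j , α' , β')

  Reachable : State → State → Set
  Reachable = Star Edge

data Cnt : Set where
  dot cross zer cA cB : Cnt

eqC : Cnt → Cnt → Bool
eqC dot   dot   = true
eqC cross cross = true
eqC zer   zer   = true
eqC cA    cA    = true
eqC cB    cB    = true
eqC _     _     = false

regC : Reg → Cnt
regC RA = cA
regC RB = cB

module Algebra {n : ℕ} (𝓜 : Minsky n) where
  open Minsky 𝓜
  open Machine 𝓜 public

  Elem : Set
  Elem = State × Cnt

  st : Elem → State
  st = proj₁

  content : Elem → Cnt
  content = proj₂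

  X : Elem → Elem
  X (i , _) = (i , cross)

  eqS : State → State → Bool
  eqS i j = ⌊ i ≟ j ⌋

  eqE : Elem → Elem → Bool
  eqE (i , c) (j , d) = eqS i j ∧ eqC c d

  isD isX isC : Elem → Bool
  isD (_ , c) = eqC c dot
  isX (_ , c) = eqC c cross
  isC x = not (isD x) ∧ not (isX x)

  minS : State → State → State
  minS i j = if toℕ i ≤ᵇ toℕ j then i else j

  _⋀_ : Elem → Elem → Elem
  x ⋀ y = if eqE x y then x else (minS (st x) (st y) , cross)

  opM : Elem → Elem → Elem
  opM (i , c) (i' , d) with eqS i i' | instrAt i
  ... | false | _ = (i' , cross)
  ... | true | nothing = (i' , cross)
  ... | true | just (inc R j) =
        if eqC c dot ∧ eqC d zer then (j , regC R)
        else if eqC c zer ∧ eqC d dot then (j , dot)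
        else if eqC c d ∧ not (eqC c dot) then (j , c)
        else (j , cross)
  ... | true | just (dec R k j) =
        if eqC c dot ∧ eqC d (regC R) then (j , zer)
        else if eqC c (regC R) ∧ eqC d dot then (j , dot)
        else if eqC c d ∧ not (eqC c dot) then (j , c)
        else (j , cross)

  opM' : Elem → Elem
  opM' (i , c) with instrAt i
  ... | just (dec R k j) = if not (eqC c (regC R)) then (k , c) else (k , cross)
  ... | _ = (i , cross)

  opI : Elem → Elem → Elem
  opI x y = if isD x then (one , dot) else if isC y then (one , zer) else (one , cross)

  opH : Elem → Elem
  opH x = if eqE x (zero , zer) ∨ eqE x (zero , dot) then (zero , zer) else (zero , cross)

  opN0 : Elem → Elem → Elem → Elem
  opN0 x y z =
    if eqE x (zero , dot) ∧ eqS (st y) (st z) then y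
    else if eqE x (zero , zer) ∧ not (isD z) ∧ eqS (st y) (st z) then z
    else X (y ⋀ z)

  okPair : Cnt → Cnt → Bool
  okPair c d = (eqC c dot ∧ eqC d zer) ∨ (eqC c zer ∧ eqC d dot) ∨ (eqC c zer ∧ eqC d zer)

  opS : Elem → Elem → Elem → Elem
  opS x y z =
    if eqE x (one , zer) ∧ eqS (st y) one ∧ eqS (st z) one ∧ okPair (content y) (content z)
    then (one , zer) else (one , cross)

  opNd : Elem → Elem → Elem → Elem → Elem
  opNd u x y z =
    if sync ∧ eqE x y ∧ not (isX x) then x
    else if sync ∧ isD u ∧ isX y then x
    else if sync ∧ isD u ∧ isX x then y
    else if sync ∧ isD u ∧ (eqE z x ∨ eqE z y) then z
    else X ((x ⋀ y) ⋀ z)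
    where
      sync : Bool
      sync = eqS (st x) (st y) ∧ eqS (st y) (st z)

  opP : Elem → Elem → Elem → Elem → Elem
  opP u v x y = if eqS (st u) (st v) then x else y

  Tuple : ℕ → Set
  Tuple m = Vec Elem m

  Relation : ℕ → Set
  Relation m = Tuple m → Bool

  _∈R_ : ∀ {m} → Tuple m → Relation m → Set
  r ∈R R = R r ≡ true

  Preserves : ∀ {k} → ((Fin k → Elem) → Elem) → ∀ {m} → Relation m → Set
  Preserves {k} f {m} R =
    (rs : Fin k → Tuple m) → (∀ j → rs j ∈R R) →
    tabulate (λ i → f (λ j → lookup (rs j) i)) ∈R R

  u2 : (Elem → Elem → Elem) → (Fin 2 → Elem) → Elem
  u2 g v = g (v zero) (v (suc zero))

  u1 : (Elem → Elem) → (Fin 1 → Elem) → Elem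
  u1 g v = g (v zero)

  u3 : (Elem → Elem → Elem → Elem) → (Fin 3 → Elem) → Elem
  u3 g v = g (v zero) (v (suc zero)) (v (suc (suc zero)))

  u4 : (Elem → Elem → Elem → Elem → Elem) → (Fin 4 → Elem) → Elem
  u4 g v = g (v zero) (v (suc zero)) (v (suc (suc zero))) (v (suc (suc (suc zero))))

  Subuniverse : ∀ {m} → Relation m → Set
  Subuniverse R =
    (∃ λ r → r ∈R R)
    × Preserves (u2 _⋀_) R
    × Preserves (u2 opM) R
    × Preserves (u1 opM') R
    × Preserves (u2 opI) R
    × Preserves (u1 opH) R
    × Preserves (u3 opN0) R
    × Preserves (u3 opS) R
    × Preserves (u4 opNd) R
    × Preserves (u4 opP) R

  Synchronized : ∀ {m} → Tuple m → Set
  Synchronized r = ∀ i j → st (lookup r i) ≡ st (lookup r j)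

  AtMostOneD : ∀ {m} → Tuple m → Set
  AtMostOneD r = ∀ i j → isD (lookup r i) ≡ true → isD (lookup r j) ≡ true → i ≡ j

  Computational : ∀ {m} → Relation m → Set
  Computational R = ∀ r → r ∈R R → Synchronized r × AtMostOneD r

  Halting : ∀ {m} → Relation m → Set
  Halting {m} R =
    ∃ λ (r : Tuple m) → r ∈R R
      × All (λ x → x ≡ (zero , zer) ⊎ x ≡ (zero , dot)) r
      × ¬ All (λ x → x ≡ (zero , zer)) r

  RelLE⊨ : ℕ → ∀ {m} → Relation m → Set
  RelLE⊨ m R =
    ∀ (k : ℕ) (f : (Fin k → Elem) → Elem) →
      (∀ (m' : ℕ) → m' ≤ m → (S : Relation m') → Subuniverse S → Preserves f S) →
      Preserves f R

  data Gen : Elem → Set where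
    g-dot  : Gen (one , dot)
    g-zer  : Gen (one , zer)
    g-meet : ∀ {x y} → Gen x → Gen y → Gen (x ⋀ y)
    g-M    : ∀ {x y} → Gen x → Gen y → Gen (opM x y)
    g-M'   : ∀ {x} → Gen x → Gen (opM' x)
    g-I    : ∀ {x y} → Gen x → Gen y → Gen (opI x y)
    g-H    : ∀ {x} → Gen x → Gen (opH x)
    g-N0   : ∀ {x y z} → Gen x → Gen y → Gen z → Gen (opN0 x y z)
    g-S    : ∀ {x y z} → Gen x → Gen y → Gen z → Gen (opS x y z)
    g-Nd   : ∀ {u x y z} → Gen u → Gen x → Gen y → Gen z → Gen (opNd u x y z)
    g-P    : ∀ {u v x y} → Gen u → Gen v → Gen x → Gen y → Gen (opP u v x y)

  record Standing : Set where
    field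
      returnsZero  : ReturnsRegistersToZero
      firstInc     : FirstIsInc
      reachFrom1   : ∀ i → Reachable one i
      reachTo0     : ∀ i → Reachable i zero
      capacity     : ℕ
      haltsCap     : HaltsWithCapacity capacity
      genHalting   : Gen (zero , dot)

-- Let f preserve all subuniverses of arity at most m − 1 and let s = f(r₁, …, r_k) with rⱼ ∈ R.
-- Deleting coordinate i from R leaves an (m − 1)-ary subuniverse, so s agrees off i with some
-- tᵢ ∈ R.  Membership in R is decidable, so it suffices to show that s ∉ R forces R to be
-- computational and not halting; in each case one basic operation rebuilds s from the tᵢ:
--  • r ∈ R unsynchronized at a, b: s = P(r, w, t_b, t_a), where w ∈ R has the constant state
--    of r_a (every state is reachable from 1, and M, M′ follow the edges of the state graph);
--  • r ∈ R with dots at a ≠ b: s = N•(u, t_p, t_q, t_c) with c ∉ {p, q} (this is where m ≥ 3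
--    is used), for a tuple u ∈ R built from r, the tᵢ, H, I and M that steers N• at p and q;
--  • R halting: s = N₀(η, t_b, t_d) where η is ⟨0,•⟩ at the dot d of s and ⟨0,0⟩ elsewhere.
--    Such an η lies in R: following the generation of ⟨0,•⟩ from ⟨1,•⟩, ⟨1,0⟩, every generated
--    x occurs in R at d with some shadow of x elsewhere, and the only shadow of ⟨0,•⟩ is ⟨0,0⟩.

module Submission where

open import Defs
open import Data.Bool using (Bool; true; false; if_then_else_; _∧_; _∨_; not)
import Data.Bool.Properties as Bool
open import Data.Empty using (⊥-elim)
open import Data.Fin using (Fin; zero; suc; toℕ; punchIn; punchOut)
open import Data.Fin.Properties using (_≟_; any?; punchIn-injective; punchInᵢ≢i; punchIn-punchOut)
open import Data.Maybe using (just; nothing)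
open import Data.Nat using (ℕ; zero; suc; _≤_; _∸_; _≤ᵇ_; s≤s)
open import Data.Nat.Properties using (≤-refl)
open import Data.Product using (∃; _×_; _,_; proj₁; proj₂)
open import Data.Sum using (_⊎_; inj₁; inj₂; [_,_]′)
open import Data.Vec using (Vec; []; _∷_; lookup; tabulate; insertAt)
open import Data.Vec.Properties
  using (lookup∘tabulate; tabulate∘lookup; tabulate-cong; insertAt-lookup; insertAt-punchIn)
open import Data.Vec.Relation.Unary.All using (All; []; _∷_)
open import Data.Vec.Relation.Unary.All.Properties using (lookup⁺)
open import Function using (_∘_)
open import Relation.Binary.Construct.Closure.ReflexiveTransitive using (ε; _◅_)
open import Relation.Binary.PropositionalEquality
open import Relation.Nullary using (¬_; Dec; yes; no; contradiction)
open import Relation.Nullary.Decidable using (⌊_⌋; ¬?; _×-dec_)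

eqC-sound : ∀ c d → eqC c d ≡ true → c ≡ d
eqC-sound dot   = λ { dot _ → refl ; cross () ; zer () ; cA () ; cB () }
eqC-sound cross = λ { dot () ; cross _ → refl ; zer () ; cA () ; cB () }
eqC-sound zer   = λ { dot () ; cross () ; zer _ → refl ; cA () ; cB () }
eqC-sound cA    = λ { dot () ; cross () ; zer () ; cA _ → refl ; cB () }
eqC-sound cB    = λ { dot () ; cross () ; zer () ; cA () ; cB _ → refl }

∧-elimˡ : ∀ x {y} → x ∧ y ≡ true → x ≡ true
∧-elimˡ true _ = refl

∧-elimʳ : ∀ x {y} → x ∧ y ≡ true → y ≡ true
∧-elimʳ true e = e

∀ᶜ : (Cnt → Bool) → Bool
∀ᶜ p = p dot ∧ p cross ∧ p zer ∧ p cA ∧ p cB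

∀ᶜ-sound : ∀ {p} → ∀ᶜ p ≡ true → ∀ c → p c ≡ true
∀ᶜ-sound {p} e dot   = ∧-elimˡ (p dot) e
∀ᶜ-sound {p} e cross = ∧-elimˡ (p cross) (∧-elimʳ (p dot) e)
∀ᶜ-sound {p} e zer   = ∧-elimˡ (p zer) (∧-elimʳ (p cross) (∧-elimʳ (p dot) e))
∀ᶜ-sound {p} e cA    =
  ∧-elimˡ (p cA) (∧-elimʳ (p zer) (∧-elimʳ (p cross) (∧-elimʳ (p dot) e)))
∀ᶜ-sound {p} e cB    =
  ∧-elimʳ (p cA) (∧-elimʳ (p zer) (∧-elimʳ (p cross) (∧-elimʳ (p dot) e)))

∀ᶜ³-sound : ∀ (p : Cnt → Cnt → Cnt → Bool) →
            ∀ᶜ (λ a → ∀ᶜ λ b → ∀ᶜ λ c → p a b c) ≡ true → ∀ a b c → p a b c ≡ true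
∀ᶜ³-sound p e a b c =
  ∀ᶜ-sound {p a b} (∀ᶜ-sound {λ b → ∀ᶜ (p a b)} (∀ᶜ-sound {λ a → ∀ᶜ λ b → ∀ᶜ (p a b)} e a) b) c

if-then-true : ∀ {a b} → a ≡ true → (if a then b else true) ≡ true → b ≡ true
if-then-true refl e = e

-- The content of N•(u,x,y,z) when x, y, z share their state.
ndᶜ : Cnt → Cnt → Cnt → Cnt → Cnt
ndᶜ cu cx cy cz =
  if eqC cx cy ∧ not (eqC cx cross) then cx
  else if eqC cu dot ∧ eqC cy cross then cx
  else if eqC cu dot ∧ eqC cx cross then cy
  else if eqC cu dot ∧ (eqC cz cx ∨ eqC cz cy) then cz
  else cross

steersᶜ : Cnt → Cnt → Bool
steersᶜ cu cv = (eqC cu dot ∧ not (eqC cv cross)) ∨ (not (eqC cu dot) ∧ eqC cv cross)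

-- The next three facts are checked by evaluation on all 125 triples of contents.
ndᶜ-first : ∀ cu cw cv → steersᶜ cu cv ≡ true → ndᶜ cu cw cv cv ≡ cv
ndᶜ-first cu cw cv steers = eqC-sound _ cv (if-then-true steers
  (∀ᶜ³-sound (λ cu cw cv → if steersᶜ cu cv then eqC (ndᶜ cu cw cv cv) cv else true) refl cu cw cv))

ndᶜ-second : ∀ cu cw cv → steersᶜ cu cv ≡ true → ndᶜ cu cv cw cv ≡ cv
ndᶜ-second cu cw cv steers = eqC-sound _ cv (if-then-true steers
  (∀ᶜ³-sound (λ cu cw cv → if steersᶜ cu cv then eqC (ndᶜ cu cv cw cv) cv else true) refl cu cw cv))

ndᶜ-third : ∀ cu cw cv → ndᶜ cu cv cv cw ≡ cv
ndᶜ-third cu cw cv =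
  eqC-sound _ cv (∀ᶜ³-sound (λ cu cw cv → eqC (ndᶜ cu cv cv cw) cv) refl cu cw cv)

any-Cnt : {P : Cnt → Set} → (∀ c → Dec (P c)) → Dec (∃ P)
any-Cnt P? with P? dot | P? cross | P? zer | P? cA | P? cB
... | yes p | _     | _     | _     | _     = yes (dot , p)
... | no _  | yes p | _     | _     | _     = yes (cross , p)
... | no _  | no _  | yes p | _     | _     = yes (zer , p)
... | no _  | no _  | no _  | yes p | _     = yes (cA , p)
... | no _  | no _  | no _  | no _  | yes p = yes (cB , p)
... | no ¬d | no ¬x | no ¬z | no ¬a | no ¬b =
  no λ { (dot , p) → ¬d p ; (cross , p) → ¬x p ; (zer , p) → ¬z p
       ; (cA , p) → ¬a p ; (cB , p) → ¬b p }

module _ {A : Set} where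

  tabulate-≗ : ∀ {m} {g : Fin m → A} {v : Vec A m} → (∀ l → g l ≡ lookup v l) → tabulate g ≡ v
  tabulate-≗ {v = v} g≗v = trans (tabulate-cong g≗v) (tabulate∘lookup v)

  lookup-ext : ∀ {m} {u v : Vec A m} → (∀ l → lookup u l ≡ lookup v l) → u ≡ v
  lookup-ext {u = u} u≗v = trans (sym (tabulate∘lookup u)) (tabulate-≗ u≗v)

  -- Once l is a numeral both sides reduce to the same term, so f need not respect ≗.
  lookup∘tabulate-under : ∀ {B : Set} {k m} (f : (Fin k → A) → B) (G : Fin k → Fin m → A) l →
                          f (λ j → lookup (tabulate (G j)) l) ≡ f (λ j → G j l)
  lookup∘tabulate-under f G zero    = refl
  lookup∘tabulate-under f G (suc l) = lookup∘tabulate-under f (λ j l′ → G j (suc l′)) l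

  ≗-off : ∀ {m} (v w : Vec A (suc m)) i → (∀ l → lookup v (punchIn i l) ≡ lookup w (punchIn i l)) →
          ∀ l → l ≢ i → lookup v l ≡ lookup w l
  ≗-off v w i v≗w l l≢i =
    subst (λ l′ → lookup v l′ ≡ lookup w l′) (punchIn-punchOut (l≢i ∘ sym))
          (v≗w (punchOut (l≢i ∘ sym)))

  insertAt-unique : ∀ {m} (v : Vec A m) (w : Vec A (suc m)) {x} i → lookup w i ≡ x →
                    (∀ l → lookup w (punchIn i l) ≡ lookup v l) → insertAt v i x ≡ w
  insertAt-unique v w {x} i w≡x w≗v = lookup-ext coordinate
    where
      coordinate : ∀ l → lookup (insertAt v i x) l ≡ lookup w l
      coordinate l with l ≟ i
      ... | yes refl = trans (insertAt-lookup v i x) (sym w≡x)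
      ... | no l≢i   =
        ≗-off (insertAt v i x) w i (λ l′ → trans (insertAt-punchIn v i x l′) (sym (w≗v l′))) l l≢i

¬All⇒∃ : ∀ {A : Set} {P Q : A → Set} {m} {xs : Vec A m} →
         All (λ x → P x ⊎ Q x) xs → ¬ All P xs → ∃ λ l → Q (lookup xs l)
¬All⇒∃ []             ¬all = contradiction [] ¬all
¬All⇒∃ (inj₂ q ∷ _)   _    = zero , q
¬All⇒∃ (inj₁ p ∷ pqs) ¬all with ¬All⇒∃ pqs (λ ps → ¬all (p ∷ ps))
... | l , q = suc l , q

avoid₁ : ∀ {k} (p : Fin (suc (suc k))) → ∃ λ c → c ≢ p
avoid₁ p = punchIn p zero , punchInᵢ≢i p zero

avoid₂ : ∀ {k} (p q : Fin (suc (suc (suc k)))) → ∃ λ c → c ≢ p × c ≢ q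
avoid₂ p q with p ≟ q
... | yes refl = let c , c≢p = avoid₁ p in c , c≢p , c≢p
... | no p≢q =
  let q′ = punchOut p≢q
      c′ , c′≢q′ = avoid₁ q′
  in punchIn p c′ , punchInᵢ≢i p c′ ,
     λ c≡q → c′≢q′ (punchIn-injective p c′ q′ (trans c≡q (sym (punchIn-punchOut p≢q))))

module _ {n : ℕ} (𝓜 : Minsky n) where
  open Minsky 𝓜
  open Algebra 𝓜

  eqS-refl : ∀ σ → eqS σ σ ≡ true
  eqS-refl σ with σ ≟ σ
  ... | yes _   = refl
  ... | no σ≢σ = contradiction refl σ≢σ

  eqS-sound : ∀ {σ τ} → eqS σ τ ≡ true → σ ≡ τ
  eqS-sound {σ} {τ} e with σ ≟ τ
  ... | yes σ≡τ = σ≡τ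

  eqS-complete : ∀ {σ τ} → σ ≡ τ → eqS σ τ ≡ true
  eqS-complete {σ} refl = eqS-refl σ

  minS-idem : ∀ σ → minS σ σ ≡ σ
  minS-idem σ with toℕ σ ≤ᵇ toℕ σ
  ... | true  = refl
  ... | false = refl

  minS-eq : ∀ {σ τ} → σ ≡ τ → minS σ τ ≡ τ
  minS-eq {σ} refl = minS-idem σ

  minS-sync : ∀ {σ τ υ} → σ ≡ τ → τ ≡ υ → minS (minS σ τ) υ ≡ υ
  minS-sync {υ = υ} σ≡τ τ≡υ = trans (cong (λ ρ → minS ρ υ) (minS-eq σ≡τ)) (minS-eq τ≡υ)

  st-if : ∀ b {σ x y} → st x ≡ σ → st y ≡ σ → st (if b then x else y) ≡ σ
  st-if true  x≡σ _ = x≡σ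
  st-if false _ y≡σ = y≡σ

  cross≢reg : ∀ R → eqC cross (regC R) ≡ false
  cross≢reg RA = refl
  cross≢reg RB = refl

  isD-dot : ∀ x → isD x ≡ true → content x ≡ dot
  isD-dot (_ , c) = eqC-sound c dot

  isX-cross : ∀ x → isX x ≡ true → content x ≡ cross
  isX-cross (_ , c) = eqC-sound c cross

  D⇒¬X : ∀ x → isD x ≡ true → isX x ≡ false
  D⇒¬X x x∈D rewrite isD-dot x x∈D = refl

  X⇒¬D : ∀ x → isX x ≡ true → isD x ≡ false
  X⇒¬D x x∈X rewrite isX-cross x x∈X = refl

  X⇒¬C : ∀ x → isX x ≡ true → isC x ≡ false
  X⇒¬C x x∈X rewrite isX-cross x x∈X = refl

  cross⇒¬D : ∀ x → content x ≡ cross → isD x ≡ false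
  cross⇒¬D (_ , .cross) refl = refl

  st-⋀ : ∀ x y → st (x ⋀ y) ≡ minS (st x) (st y)
  st-⋀ (σ , c) (τ , d) with eqE (σ , c) (τ , d) in e
  ... | false = refl
  ... | true with refl ← eqS-sound {σ} {τ} (∧-elimˡ (eqS σ τ) e) = sym (minS-idem σ)

  ⋀-crossˡ : ∀ σ τ d → content ((σ , cross) ⋀ (τ , d)) ≡ cross
  ⋀-crossˡ σ τ d with eqE (σ , cross) (τ , d)
  ... | true  = refl
  ... | false = refl

  ⋀-crossʳ : ∀ σ τ c → content ((σ , c) ⋀ (τ , cross)) ≡ cross
  ⋀-crossʳ σ τ c with eqE (σ , c) (τ , cross) in e
  ... | true  = eqC-sound c cross (∧-elimʳ (eqS σ τ) e)
  ... | false = refl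

  ⋀-zer : ∀ σ τ c d →
          content ((σ , c) ⋀ (τ , d)) ≡ cross ⊎ content ((σ , zer) ⋀ (τ , zer)) ≡ zer
  ⋀-zer σ τ c d with eqS σ τ
  ... | true  = inj₂ refl
  ... | false = inj₁ refl

  M-target : State → State → State
  M-target σ τ with eqS σ τ | instrAt σ
  ... | true | just (inc _ j)   = j
  ... | true | just (dec _ _ j) = j
  ... | _    | _                = τ

  st-opM : ∀ σ τ c d → st (opM (σ , c) (τ , d)) ≡ M-target σ τ
  st-opM σ τ c d with eqS σ τ | instrAt σ
  ... | false | _       = refl
  ... | true  | nothing = refl
  ... | true  | just (inc R j) =
    st-if (eqC c dot ∧ eqC d zer) refl
      (st-if (eqC c zer ∧ eqC d dot) refl (st-if (eqC c d ∧ not (eqC c dot)) refl refl))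
  ... | true  | just (dec R k j) =
    st-if (eqC c dot ∧ eqC d (regC R)) refl
      (st-if (eqC c (regC R) ∧ eqC d dot) refl (st-if (eqC c d ∧ not (eqC c dot)) refl refl))

  private
    cross-unless-self : ∀ {j} c b → content (if eqC c cross ∧ b then (j , c) else (j , cross)) ≡ cross
    cross-unless-self c b with eqC c cross in e
    ... | false = refl
    ... | true with b
    ...   | true  = eqC-sound c cross e
    ...   | false = refl

  M-crossˡ : ∀ σ τ d → content (opM (σ , cross) (τ , d)) ≡ cross
  M-crossˡ σ τ d with eqS σ τ | instrAt σ
  ... | false | _       = refl
  ... | true  | nothing = refl
  ... | true  | just (inc R j) = cong proj₂ (Bool.if-eta (eqC cross d ∧ true))
  ... | true  | just (dec R k j) rewrite cross≢reg R = cong proj₂ (Bool.if-eta (eqC cross d ∧ true))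

  M-crossʳ : ∀ σ τ c → content (opM (σ , c) (τ , cross)) ≡ cross
  M-crossʳ σ τ c with eqS σ τ | instrAt σ
  ... | false | _       = refl
  ... | true  | nothing = refl
  ... | true  | just (inc R j)
    rewrite Bool.∧-zeroʳ (eqC c dot) | Bool.∧-zeroʳ (eqC c zer) = cross-unless-self c (not (eqC c dot))
  ... | true  | just (dec R k j)
    rewrite cross≢reg R | Bool.∧-zeroʳ (eqC c dot) | Bool.∧-zeroʳ (eqC c (regC R)) =
    cross-unless-self c (not (eqC c dot))

  M-zer : ∀ σ τ c d →
          content (opM (σ , c) (τ , d)) ≡ cross ⊎ content (opM (σ , zer) (τ , zer)) ≡ zer
  M-zer σ τ c d with eqS σ τ | instrAt σ
  ... | false | _       = inj₁ refl
  ... | true  | nothing = inj₁ refl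
  ... | true  | just (inc R j)    = inj₂ refl
  ... | true  | just (dec RA k j) = inj₂ refl
  ... | true  | just (dec RB k j) = inj₂ refl

  opM-first : ∀ {R τ} → prog zero ≡ inc R τ → opM (one , zer) (one , dot) ≡ (τ , dot)
  opM-first first rewrite first = refl

  M'-target : State → State
  M'-target σ with instrAt σ
  ... | just (dec _ k _) = k
  ... | _                = σ

  st-opM' : ∀ σ c → st (opM' (σ , c)) ≡ M'-target σ
  st-opM' σ c with instrAt σ
  ... | nothing          = refl
  ... | just (inc R j)   = refl
  ... | just (dec R k j) = st-if (not (eqC c (regC R))) refl refl

  M'-cross : ∀ σ → content (opM' (σ , cross)) ≡ cross
  M'-cross σ with instrAt σ
  ... | nothing          = refl
  ... | just (inc R j)   = refl
  ... | just (dec R k j) rewrite cross≢reg R = refl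

  M'-zer : ∀ σ c → content (opM' (σ , c)) ≡ cross ⊎ content (opM' (σ , zer)) ≡ zer
  M'-zer σ c with instrAt σ
  ... | nothing           = inj₁ refl
  ... | just (inc R j)    = inj₁ refl
  ... | just (dec RA k j) = inj₂ refl
  ... | just (dec RB k j) = inj₂ refl

  st-opH : ∀ x → st (opH x) ≡ zero
  st-opH x = st-if (eqE x (zero , zer) ∨ eqE x (zero , dot)) refl refl

  H-cross : ∀ σ → content (opH (σ , cross)) ≡ cross
  H-cross zero    = refl
  H-cross (suc _) = refl

  H-zer : ∀ σ c → content (opH (σ , c)) ≡ cross ⊎ content (opH (σ , zer)) ≡ zer
  H-zer zero    _ = inj₂ refl
  H-zer (suc _) _ = inj₁ refl

  isD-opH : ∀ x → isD (opH x) ≡ false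
  isD-opH x with eqE x (zero , zer) ∨ eqE x (zero , dot)
  ... | true  = refl
  ... | false = refl

  opH-halting : ∀ {x} → x ≡ (zero , zer) ⊎ x ≡ (zero , dot) → opH x ≡ (zero , zer)
  opH-halting (inj₁ refl) = refl
  opH-halting (inj₂ refl) = refl

  opI-cases : ∀ x y → opI x y ≡ (one , dot) ⊎ opI x y ≡ (one , zer) ⊎ opI x y ≡ (one , cross)
  opI-cases x y with isD x | isC y
  ... | true  | _     = inj₁ refl
  ... | false | true  = inj₂ (inj₁ refl)
  ... | false | false = inj₂ (inj₂ refl)

  st-opI : ∀ x y → st (opI x y) ≡ one
  st-opI x y = st-if (isD x) refl (st-if (isC y) refl refl)

  opI-D : ∀ x y → isD x ≡ true → opI x y ≡ (one , dot)
  opI-D x y x∈D rewrite x∈D = refl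

  opI-C : ∀ x y → isD x ≡ false → isC y ≡ true → opI x y ≡ (one , zer)
  opI-C x y x∉D y∈C rewrite x∉D | y∈C = refl

  opI-X : ∀ x y → isD x ≡ false → isC y ≡ false → opI x y ≡ (one , cross)
  opI-X x y x∉D y∉C rewrite x∉D | y∉C = refl

  opS-cases : ∀ x y z → opS x y z ≡ (one , zer) ⊎ opS x y z ≡ (one , cross)
  opS-cases x y z with eqE x (one , zer) ∧ eqS (st y) one ∧ eqS (st z) one ∧ okPair (content y) (content z)
  ... | true  = inj₁ refl
  ... | false = inj₂ refl

  st-opS : ∀ x y z → st (opS x y z) ≡ one
  st-opS x y z = [ cong st , cong st ]′ (opS-cases x y z)

  opP-cases : ∀ u v x y → opP u v x y ≡ x ⊎ opP u v x y ≡ y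
  opP-cases u v x y with eqS (st u) (st v)
  ... | true  = inj₁ refl
  ... | false = inj₂ refl

  opN0-cases : ∀ a y z → (st y ≡ st z × (opN0 a y z ≡ y ⊎ opN0 a y z ≡ z)) ⊎ opN0 a y z ≡ X (y ⋀ z)
  opN0-cases a y z with eqE a (zero , dot) ∧ eqS (st y) (st z) in e₁
  ... | true = inj₁ (eqS-sound (∧-elimʳ (eqE a (zero , dot)) e₁) , inj₁ refl)
  ... | false with eqE a (zero , zer) ∧ not (isD z) ∧ eqS (st y) (st z) in e₂
  ...   | true  = inj₁ (eqS-sound (∧-elimʳ (not (isD z)) (∧-elimʳ (eqE a (zero , zer)) e₂)) , inj₂ refl)
  ...   | false = inj₂ refl

  st-opN0 : ∀ a y z → st (opN0 a y z) ≡ minS (st y) (st z)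
  st-opN0 a y z with opN0-cases a y z
  ... | inj₁ (y~z , inj₁ e) = trans (cong st e) (trans y~z (sym (minS-eq y~z)))
  ... | inj₁ (y~z , inj₂ e) = trans (cong st e) (sym (minS-eq y~z))
  ... | inj₂ e              = trans (cong st e) (st-⋀ y z)

  opN0-dot : ∀ y z → st y ≡ st z → opN0 (zero , dot) y z ≡ y
  opN0-dot y z y~z rewrite eqS-complete y~z = refl

  opN0-zer : ∀ y z → isD z ≡ false → st y ≡ st z → opN0 (zero , zer) y z ≡ z
  opN0-zer y z z∉D y~z rewrite z∉D | eqS-complete y~z = refl

  opNd-cases : ∀ u x y z →
    (st x ≡ st y × st y ≡ st z × (opNd u x y z ≡ x ⊎ opNd u x y z ≡ y ⊎ opNd u x y z ≡ z))
    ⊎ opNd u x y z ≡ X ((x ⋀ y) ⋀ z)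
  opNd-cases u x y z with eqS (st x) (st y) in e₁ | eqS (st y) (st z) in e₂
  ... | false | _     = inj₂ refl
  ... | true  | false = inj₂ refl
  ... | true  | true with eqC (content x) (content y) ∧ not (isX x)
  ...   | true = inj₁ (eqS-sound e₁ , eqS-sound e₂ , inj₁ refl)
  ...   | false with isD u ∧ isX y
  ...     | true = inj₁ (eqS-sound e₁ , eqS-sound e₂ , inj₁ refl)
  ...     | false with isD u ∧ isX x
  ...       | true = inj₁ (eqS-sound e₁ , eqS-sound e₂ , inj₂ (inj₁ refl))
  ...       | false with isD u ∧ (eqE z x ∨ eqE z y)
  ...         | true  = inj₁ (eqS-sound e₁ , eqS-sound e₂ , inj₂ (inj₂ refl))
  ...         | false = inj₂ refl

  st-opNd : ∀ u x y z → st (opNd u x y z) ≡ minS (minS (st x) (st y)) (st z)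
  st-opNd u x y z with opNd-cases u x y z
  ... | inj₁ (x~y , y~z , inj₁ e) = trans (cong st e) (trans (trans x~y y~z) (sym (minS-sync x~y y~z)))
  ... | inj₁ (x~y , y~z , inj₂ (inj₁ e)) = trans (cong st e) (trans y~z (sym (minS-sync x~y y~z)))
  ... | inj₁ (x~y , y~z , inj₂ (inj₂ e)) = trans (cong st e) (sym (minS-sync x~y y~z))
  ... | inj₂ e = trans (cong st e) (trans (st-⋀ (x ⋀ y) z) (cong (λ σ → minS σ (st z)) (st-⋀ x y)))

  content-opNd : ∀ ρ σ cu cx cy cz →
                 content (opNd (ρ , cu) (σ , cx) (σ , cy) (σ , cz)) ≡ ndᶜ cu cx cy cz
  content-opNd ρ σ cu cx cy cz rewrite eqS-refl σ with eqC cx cy ∧ not (eqC cx cross)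
  ... | true = refl
  ... | false with eqC cu dot ∧ eqC cy cross
  ...   | true = refl
  ...   | false with eqC cu dot ∧ eqC cx cross
  ...     | true = refl
  ...     | false with eqC cu dot ∧ (eqC cz cx ∨ eqC cz cy)
  ...       | true  = refl
  ...       | false = refl

  opNd-sync : ∀ ρ σ cu cx cy cz → opNd (ρ , cu) (σ , cx) (σ , cy) (σ , cz) ≡ (σ , ndᶜ cu cx cy cz)
  opNd-sync ρ σ cu cx cy cz =
    cong₂ _,_ (trans (st-opNd (ρ , cu) (σ , cx) (σ , cy) (σ , cz)) (minS-sync refl refl))
              (content-opNd ρ σ cu cx cy cz)

  data Steers (u v : Elem) : Set where
    dot-steers   : isD u ≡ true  → isX v ≡ false → Steers u v
    cross-steers : isD u ≡ false → isX v ≡ true  → Steers u v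

  steersᶜ-sound : ∀ {u v} → Steers u v → steersᶜ (content u) (content v) ≡ true
  steersᶜ-sound (dot-steers u∈D v∉X)   rewrite u∈D | v∉X = refl
  steersᶜ-sound (cross-steers u∉D v∈X) rewrite u∉D | v∈X = refl

  nd-first : ∀ u w v → Steers u v → st w ≡ st v → opNd u w v v ≡ v
  nd-first (ρ , cu) (σ , cw) (.σ , cv) steers refl = trans (opNd-sync ρ σ cu cw cv cv)
    (cong (σ ,_) (ndᶜ-first cu cw cv (steersᶜ-sound steers)))

  nd-second : ∀ u w v → Steers u v → st w ≡ st v → opNd u v w v ≡ v
  nd-second (ρ , cu) (σ , cw) (.σ , cv) steers refl = trans (opNd-sync ρ σ cu cv cw cv)
    (cong (σ ,_) (ndᶜ-second cu cw cv (steersᶜ-sound steers)))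

  nd-third : ∀ u w v → st w ≡ st v → opNd u v v w ≡ v
  nd-third (ρ , cu) (σ , cw) (.σ , cv) refl = trans (opNd-sync ρ σ cu cv cv cw)
    (cong (σ ,_) (ndᶜ-third cu cw cv))

  -- The relation along which ⟨1,•⟩ ↦ ⟨1,0⟩, ⟨1,0⟩ ↦ ⟨1,0⟩ extends to the subalgebra they generate.
  data Shadow : Elem → Elem → Set where
    cross-shadow : ∀ {σ c} → Shadow (σ , cross) (σ , c)
    zer-shadow   : ∀ {σ c} → Shadow (σ , c) (σ , zer)

  shadow : ∀ {x y} → st x ≡ st y → content x ≡ cross ⊎ content y ≡ zer → Shadow x y
  shadow {_ , _} {_ , _} refl (inj₁ refl) = cross-shadow
  shadow {_ , _} {_ , _} refl (inj₂ refl) = zer-shadow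

  shadow-st : ∀ {x y} → Shadow x y → st x ≡ st y
  shadow-st cross-shadow = refl
  shadow-st zer-shadow   = refl

  shadow-of-dot : ∀ {σ y} → Shadow (σ , dot) y → y ≡ (σ , zer)
  shadow-of-dot zer-shadow = refl

  shadow₁ : (g : Elem → Elem) →
            (∀ σ c d → st (g (σ , c)) ≡ st (g (σ , d))) →
            (∀ σ → content (g (σ , cross)) ≡ cross) →
            (∀ σ c → content (g (σ , c)) ≡ cross ⊎ content (g (σ , zer)) ≡ zer) →
            ∀ {x y} → Shadow x y → Shadow (g x) (g y)
  shadow₁ g st-det on-cross on-zer (cross-shadow {σ} {c}) = shadow (st-det σ cross c) (inj₁ (on-cross σ))
  shadow₁ g st-det on-cross on-zer (zer-shadow {σ} {c})   = shadow (st-det σ c zer) (on-zer σ c)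

  shadow₂ : (g : Elem → Elem → Elem) →
            (∀ σ τ c d c′ d′ → st (g (σ , c) (τ , d)) ≡ st (g (σ , c′) (τ , d′))) →
            (∀ σ τ d → content (g (σ , cross) (τ , d)) ≡ cross) →
            (∀ σ τ c → content (g (σ , c) (τ , cross)) ≡ cross) →
            (∀ σ τ c d →
               content (g (σ , c) (τ , d)) ≡ cross ⊎ content (g (σ , zer) (τ , zer)) ≡ zer) →
            ∀ {x₁ y₁ x₂ y₂} → Shadow x₁ y₁ → Shadow x₂ y₂ → Shadow (g x₁ x₂) (g y₁ y₂)
  shadow₂ g st-det crossˡ crossʳ on-zer (cross-shadow {σ} {c}) (cross-shadow {τ} {d}) =
    shadow (st-det σ τ cross cross c d) (inj₁ (crossˡ σ τ cross))
  shadow₂ g st-det crossˡ crossʳ on-zer (cross-shadow {σ} {c}) (zer-shadow {τ} {d}) =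
    shadow (st-det σ τ cross d c zer) (inj₁ (crossˡ σ τ d))
  shadow₂ g st-det crossˡ crossʳ on-zer (zer-shadow {σ} {c}) (cross-shadow {τ} {d}) =
    shadow (st-det σ τ c cross zer d) (inj₁ (crossʳ σ τ c))
  shadow₂ g st-det crossˡ crossʳ on-zer (zer-shadow {σ} {c}) (zer-shadow {τ} {d}) =
    shadow (st-det σ τ c d zer zer) (on-zer σ τ c d)

  shadow-⋀ : ∀ {x₁ y₁ x₂ y₂} → Shadow x₁ y₁ → Shadow x₂ y₂ → Shadow (x₁ ⋀ x₂) (y₁ ⋀ y₂)
  shadow-⋀ = shadow₂ _⋀_
    (λ σ τ c d c′ d′ → trans (st-⋀ (σ , c) (τ , d)) (sym (st-⋀ (σ , c′) (τ , d′))))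
    ⋀-crossˡ ⋀-crossʳ ⋀-zer

  shadow-M : ∀ {x₁ y₁ x₂ y₂} → Shadow x₁ y₁ → Shadow x₂ y₂ → Shadow (opM x₁ x₂) (opM y₁ y₂)
  shadow-M = shadow₂ opM
    (λ σ τ c d c′ d′ → trans (st-opM σ τ c d) (sym (st-opM σ τ c′ d′)))
    M-crossˡ M-crossʳ M-zer

  shadow-M' : ∀ {x y} → Shadow x y → Shadow (opM' x) (opM' y)
  shadow-M' = shadow₁ opM' (λ σ c d → trans (st-opM' σ c) (sym (st-opM' σ d))) M'-cross M'-zer

  shadow-H : ∀ {x y} → Shadow x y → Shadow (opH x) (opH y)
  shadow-H = shadow₁ opH (λ σ c d → trans (st-opH (σ , c)) (sym (st-opH (σ , d)))) H-cross H-zer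

  Congruent : ∀ {k} → ((Fin k → Elem) → Elem) → Set
  Congruent f = ∀ {xs ys} → (∀ j → xs j ≡ ys j) → f xs ≡ f ys

  u1-congruent : ∀ g → Congruent (u1 g)
  u1-congruent g xs≗ys = cong g (xs≗ys zero)

  u2-congruent : ∀ g → Congruent (u2 g)
  u2-congruent g xs≗ys = cong₂ g (xs≗ys zero) (xs≗ys (suc zero))

  u3-congruent : ∀ g → Congruent (u3 g)
  u3-congruent g xs≗ys rewrite xs≗ys zero | xs≗ys (suc zero) | xs≗ys (suc (suc zero)) = refl

  u4-congruent : ∀ g → Congruent (u4 g)
  u4-congruent g xs≗ys
    rewrite xs≗ys zero | xs≗ys (suc zero) | xs≗ys (suc (suc zero)) | xs≗ys (suc (suc (suc zero))) = refl

  module _ {m} {R : Relation m} where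

    nonempty : Subuniverse R → ∃ λ r → r ∈R R
    nonempty (r , _) = r

    ⋀-closed : Subuniverse R → Preserves (u2 _⋀_) R
    ⋀-closed (_ , p , _) = p

    M-closed : Subuniverse R → Preserves (u2 opM) R
    M-closed (_ , _ , p , _) = p

    M'-closed : Subuniverse R → Preserves (u1 opM') R
    M'-closed (_ , _ , _ , p , _) = p

    I-closed : Subuniverse R → Preserves (u2 opI) R
    I-closed (_ , _ , _ , _ , p , _) = p

    H-closed : Subuniverse R → Preserves (u1 opH) R
    H-closed (_ , _ , _ , _ , _ , p , _) = p

    N0-closed : Subuniverse R → Preserves (u3 opN0) R
    N0-closed (_ , _ , _ , _ , _ , _ , p , _) = p

    S-closed : Subuniverse R → Preserves (u3 opS) R
    S-closed (_ , _ , _ , _ , _ , _ , _ , p , _) = p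

    Nd-closed : Subuniverse R → Preserves (u4 opNd) R
    Nd-closed (_ , _ , _ , _ , _ , _ , _ , _ , p , _) = p

    P-closed : Subuniverse R → Preserves (u4 opP) R
    P-closed (_ , _ , _ , _ , _ , _ , _ , _ , _ , p) = p

  module Closure {m} (R : Relation m) where

    app₂-∈ : ∀ g {x y} → Preserves (u2 g) R → x ∈R R → y ∈R R →
             tabulate (λ l → g (lookup x l) (lookup y l)) ∈R R
    app₂-∈ g {x} {y} g-pres x∈R y∈R =
      g-pres (lookup (x ∷ y ∷ [])) (lookup⁺ {P = _∈R R} (x∈R ∷ y∈R ∷ []))

    ∈-pointwise : ∀ {k} (f : (Fin k → Elem) → Elem) → Preserves f R →
                  (rs : Vec (Tuple m) k) → All (_∈R R) rs →
                  ∀ {v} → (∀ l → f (λ j → lookup (lookup rs j) l) ≡ lookup v l) → v ∈R R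
    ∈-pointwise f f-pres rs rs∈R f≗v =
      subst (_∈R R) (tabulate-≗ f≗v) (f-pres (lookup rs) (lookup⁺ rs∈R))

  -- Realized elements

  module Split {m} {R : Relation m} (SU : Subuniverse R) (d : Fin m) where

    split : Elem → Elem → Tuple m
    split x y = tabulate (λ l → if ⌊ l ≟ d ⌋ then x else y)

    lookup-split : ∀ x y l → lookup (split x y) l ≡ (if ⌊ l ≟ d ⌋ then x else y)
    lookup-split x y = lookup∘tabulate _

    split-at : ∀ x y → lookup (split x y) d ≡ x
    split-at x y with d ≟ d | lookup-split x y d
    ... | yes _   | e = e
    ... | no d≢d | _ = contradiction refl d≢d

    split-off : ∀ x y {l} → l ≢ d → lookup (split x y) l ≡ y
    split-off x y {l} l≢d with l ≟ d | lookup-split x y l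
    ... | yes l≡d | _ = contradiction l≡d l≢d
    ... | no _    | e = e

    split-closed : ∀ {k} {f : (Fin k → Elem) → Elem} → Congruent f → Preserves f R →
                   (xs ys : Fin k → Elem) → (∀ j → split (xs j) (ys j) ∈R R) → split (f xs) (f ys) ∈R R
    split-closed {f = f} f-cong f-pres xs ys splits =
      subst (_∈R R) (tabulate-cong coordinate) (f-pres (λ j → split (xs j) (ys j)) splits)
      where
        coordinate : ∀ l →
                     f (λ j → lookup (split (xs j) (ys j)) l) ≡ (if ⌊ l ≟ d ⌋ then f xs else f ys)
        coordinate l with ⌊ l ≟ d ⌋ | f-cong {ys = λ j → if ⌊ l ≟ d ⌋ then xs j else ys j}
                                              (λ j → lookup-split (xs j) (ys j) l)
        ... | true  | e = e
        ... | false | e = e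

    record Realized (x : Elem) : Set where
      field
        shade    : Elem
        shadowed : Shadow x shade
        split-∈  : split x shade ∈R R
    open Realized

    shades : ∀ {k} {xs : Vec Elem k} → All Realized xs → Vec Elem k
    shades []       = []
    shades (r ∷ rs) = shade r ∷ shades rs

    shades-split : ∀ {k} {xs : Vec Elem k} (rs : All Realized xs) j →
                   split (lookup xs j) (lookup (shades rs) j) ∈R R
    shades-split (r ∷ _)  zero    = split-∈ r
    shades-split (_ ∷ rs) (suc j) = shades-split rs j

    realized-op : ∀ {k} {f : (Fin k → Elem) → Elem} → Congruent f → Preserves f R →
                  ∀ {xs} (rs : All Realized xs) → Shadow (f (lookup xs)) (f (lookup (shades rs))) →
                  Realized (f (lookup xs))
    realized-op f-cong f-pres {xs} rs f-shadow = record
      { shade    = _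
      ; shadowed = f-shadow
      ; split-∈  = split-closed f-cong f-pres (lookup xs) (lookup (shades rs)) (shades-split rs)
      }

    realized-cross : ∀ {k} {f : (Fin k → Elem) → Elem} → Congruent f → Preserves f R →
                     ∀ {xs} (rs : All Realized xs) → content (f (lookup xs)) ≡ cross →
                     st (f (lookup xs)) ≡ st (f (lookup (shades rs))) → Realized (f (lookup xs))
    realized-cross f-cong f-pres rs f-cross f-st = realized-op f-cong f-pres rs (shadow f-st (inj₁ f-cross))

    module _ (dot-realized : Realized (one , dot)) (zer-realized : Realized (one , zer)) where

      realized₁ : ∀ g → Preserves (u1 g) R → (∀ {x y} → Shadow x y → Shadow (g x) (g y)) →
                  ∀ {x} → Realized x → Realized (g x)
      realized₁ g g-pres g-shadow rx = realized-op (u1-congruent g) g-pres (rx ∷ []) (g-shadow (shadowed rx))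

      realized₂ : ∀ g → Preserves (u2 g) R →
                  (∀ {x₁ y₁ x₂ y₂} → Shadow x₁ y₁ → Shadow x₂ y₂ → Shadow (g x₁ x₂) (g y₁ y₂)) →
                  ∀ {x y} → Realized x → Realized y → Realized (g x y)
      realized₂ g g-pres g-shadow rx ry =
        realized-op (u2-congruent g) g-pres (rx ∷ ry ∷ []) (g-shadow (shadowed rx) (shadowed ry))

      realized-I : ∀ {x y} → Realized x → Realized y → Realized (opI x y)
      realized-I {x} {y} rx ry with opI-cases x y
      ... | inj₁ e        = subst Realized (sym e) dot-realized
      ... | inj₂ (inj₁ e) = subst Realized (sym e) zer-realized
      ... | inj₂ (inj₂ e) = realized-cross (u2-congruent opI) (I-closed SU) (rx ∷ ry ∷ []) (cong content e)
                              (trans (st-opI x y) (sym (st-opI (shade rx) (shade ry))))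

      realized-S : ∀ {x y z} → Realized x → Realized y → Realized z → Realized (opS x y z)
      realized-S {x} {y} {z} rx ry rz with opS-cases x y z
      ... | inj₁ e = subst Realized (sym e) zer-realized
      ... | inj₂ e = realized-cross (u3-congruent opS) (S-closed SU) (rx ∷ ry ∷ rz ∷ []) (cong content e)
                       (trans (st-opS x y z) (sym (st-opS (shade rx) (shade ry) (shade rz))))

      realized-N0 : ∀ {a y z} → Realized a → Realized y → Realized z → Realized (opN0 a y z)
      realized-N0 {a} {y} {z} ra ry rz with opN0-cases a y z
      ... | inj₁ (_ , inj₁ e) = subst Realized (sym e) ry
      ... | inj₁ (_ , inj₂ e) = subst Realized (sym e) rz
      ... | inj₂ e = realized-cross (u3-congruent opN0) (N0-closed SU) (ra ∷ ry ∷ rz ∷ []) (cong content e)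
                       (trans (st-opN0 a y z)
                              (trans (cong₂ minS (shadow-st (shadowed ry)) (shadow-st (shadowed rz)))
                                     (sym (st-opN0 (shade ra) (shade ry) (shade rz)))))

      realized-Nd : ∀ {u x y z} → Realized u → Realized x → Realized y → Realized z → Realized (opNd u x y z)
      realized-Nd {u} {x} {y} {z} ru rx ry rz with opNd-cases u x y z
      ... | inj₁ (_ , _ , inj₁ e)        = subst Realized (sym e) rx
      ... | inj₁ (_ , _ , inj₂ (inj₁ e)) = subst Realized (sym e) ry
      ... | inj₁ (_ , _ , inj₂ (inj₂ e)) = subst Realized (sym e) rz
      ... | inj₂ e = realized-cross (u4-congruent opNd) (Nd-closed SU) (ru ∷ rx ∷ ry ∷ rz ∷ []) (cong content e)
                       (trans (st-opNd u x y z)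
                              (trans (cong₂ minS (cong₂ minS (shadow-st (shadowed rx)) (shadow-st (shadowed ry)))
                                                 (shadow-st (shadowed rz)))
                                     (sym (st-opNd (shade ru) (shade rx) (shade ry) (shade rz)))))

      realized-P : ∀ u v {x y} → Realized x → Realized y → Realized (opP u v x y)
      realized-P u v {x} {y} rx ry with opP-cases u v x y
      ... | inj₁ e = subst Realized (sym e) rx
      ... | inj₂ e = subst Realized (sym e) ry

      generated⇒realized : ∀ {x} → Gen x → Realized x
      generated⇒realized g-dot             = dot-realized
      generated⇒realized g-zer             = zer-realized
      generated⇒realized (g-meet a b)      =
        realized₂ _⋀_ (⋀-closed SU) shadow-⋀ (generated⇒realized a) (generated⇒realized b)
      generated⇒realized (g-M a b)         =
        realized₂ opM (M-closed SU) shadow-M (generated⇒realized a) (generated⇒realized b)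
      generated⇒realized (g-M' a)          = realized₁ opM' (M'-closed SU) shadow-M' (generated⇒realized a)
      generated⇒realized (g-I a b)         = realized-I (generated⇒realized a) (generated⇒realized b)
      generated⇒realized (g-H a)           = realized₁ opH (H-closed SU) shadow-H (generated⇒realized a)
      generated⇒realized (g-N0 a b c)      =
        realized-N0 (generated⇒realized a) (generated⇒realized b) (generated⇒realized c)
      generated⇒realized (g-S a b c)       =
        realized-S (generated⇒realized a) (generated⇒realized b) (generated⇒realized c)
      generated⇒realized (g-Nd a b c e)    = realized-Nd (generated⇒realized a) (generated⇒realized b)
                                                         (generated⇒realized c) (generated⇒realized e)
      generated⇒realized (g-P {u} {v} _ _ a b) = realized-P u v (generated⇒realized a) (generated⇒realized b)

  -- Tuples of constant state

  edge-target : ∀ {σ τ} → Edge σ τ → τ ≡ M-target σ σ ⊎ τ ≡ M'-target σ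
  edge-target {zero}  (_ , _ , _ , _ , refl) = inj₁ refl
  edge-target {suc i} (α , β , _ , _ , e) rewrite eqS-refl (suc i) with prog i
  ... | inc RA j = inj₁ (sym (cong proj₁ e))
  ... | inc RB j = inj₁ (sym (cong proj₁ e))
  edge-target {suc i} (zero  , β , _ , _ , e) | dec RA k j = inj₂ (sym (cong proj₁ e))
  edge-target {suc i} (suc α , β , _ , _ , e) | dec RA k j = inj₁ (sym (cong proj₁ e))
  edge-target {suc i} (α , zero  , _ , _ , e) | dec RB k j = inj₂ (sym (cong proj₁ e))
  edge-target {suc i} (α , suc β , _ , _ , e) | dec RB k j = inj₁ (sym (cong proj₁ e))

  module Constant {m} {R : Relation m} (SU : Subuniverse R) where

    Constant : State → Set
    Constant σ = ∃ λ w → w ∈R R × (∀ l → st (lookup w l) ≡ σ)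

    constant-one : Constant one
    constant-one with r , r∈R ← nonempty SU =
      tabulate (λ l → opI (lookup r l) (lookup r l)) ,
      I-closed SU (λ _ → r) (λ _ → r∈R) ,
      λ l → trans (cong st (lookup∘tabulate _ l)) (st-opI (lookup r l) (lookup r l))

    constant-image : ∀ {k} {f : (Fin k → Elem) → Elem} {σ τ} → Preserves f R →
                     (∀ xs → (∀ j → st (xs j) ≡ σ) → st (f xs) ≡ τ) → Constant σ → Constant τ
    constant-image {f = f} f-pres f-st (w , w∈R , w-st) =
      tabulate (λ l → f (λ _ → lookup w l)) ,
      f-pres (λ _ → w) (λ _ → w∈R) ,
      λ l → trans (cong st (lookup∘tabulate _ l)) (f-st _ (λ _ → w-st l))

    constant-M : ∀ {σ} → Constant σ → Constant (M-target σ σ)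
    constant-M {σ} = constant-image {f = u2 opM} {σ} (M-closed SU)
                       λ xs xs-st → st-M (xs zero) (xs (suc zero)) (xs-st _) (xs-st _)
      where
        st-M : ∀ x y → st x ≡ σ → st y ≡ σ → st (opM x y) ≡ M-target σ σ
        st-M (_ , c) (_ , d) refl refl = st-opM σ σ c d

    constant-M' : ∀ {σ} → Constant σ → Constant (M'-target σ)
    constant-M' {σ} = constant-image {f = u1 opM'} {σ} (M'-closed SU) λ xs xs-st → st-M' (xs zero) (xs-st _)
      where
        st-M' : ∀ x → st x ≡ σ → st (opM' x) ≡ M'-target σ
        st-M' (_ , c) refl = st-opM' σ c

    constant-reachable : ∀ {σ τ} → Reachable σ τ → Constant σ → Constant τ
    constant-reachable ε        w = w
    constant-reachable {σ} (e ◅ es) w = constant-reachable es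
      ([ (λ τ≡ → subst Constant (sym τ≡) (constant-M w)) , (λ τ≡ → subst Constant (sym τ≡) (constant-M' w)) ]′
         (edge-target {σ} e))

  -- Deleting a coordinate

  any-Elem : {P : Elem → Set} → (∀ x → Dec (P x)) → Dec (∃ P)
  any-Elem P? with any? (λ σ → any-Cnt (λ c → P? (σ , c)))
  ... | yes (σ , c , p) = yes ((σ , c) , p)
  ... | no ¬p           = no λ { ((σ , c) , p) → ¬p (σ , c , p) }

  module Deletion {m} (R : Relation (suc m)) (i : Fin (suc m)) where

    Extends : Tuple m → Set
    Extends v = ∃ λ x → insertAt v i x ∈R R

    extends? : ∀ v → Dec (Extends v)
    extends? v = any-Elem (λ x → R (insertAt v i x) Bool.≟ true)

    deleted : Relation m
    deleted v = ⌊ extends? v ⌋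

    deleted-sound : ∀ {v} → v ∈R deleted → Extends v
    deleted-sound {v} v∈ with extends? v
    ... | yes ext = ext

    deleted-complete : ∀ {v} → Extends v → v ∈R deleted
    deleted-complete {v} ext with extends? v
    ... | yes _   = refl
    ... | no ¬ext = contradiction ext ¬ext

    restrict : Tuple (suc m) → Tuple m
    restrict r = tabulate (λ l → lookup r (punchIn i l))

    restrict-∈ : ∀ {r} → r ∈R R → restrict r ∈R deleted
    restrict-∈ {r} r∈R = deleted-complete (lookup r i , subst (_∈R R) (sym r≡) r∈R)
      where r≡ = insertAt-unique (restrict r) r i refl (λ l → sym (lookup∘tabulate _ l))

    deleted-preserved : ∀ {k} {f : (Fin k → Elem) → Elem} → Congruent f → Preserves f R →
                        Preserves f deleted
    deleted-preserved {f = f} f-cong f-pres vs vs∈ =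
      deleted-complete (f xs , subst (_∈R R) (sym (insertAt-unique image image′ i at-i off-i)) (f-pres ws ws∈R))
      where
        xs : ∀ j → Elem
        xs j = proj₁ (deleted-sound (vs∈ j))
        ws : ∀ j → Tuple (suc m)
        ws j = insertAt (vs j) i (xs j)
        ws∈R : ∀ j → ws j ∈R R
        ws∈R j = proj₂ (deleted-sound (vs∈ j))
        image : Tuple m
        image = tabulate (λ l → f (λ j → lookup (vs j) l))
        image′ : Tuple (suc m)
        image′ = tabulate (λ l → f (λ j → lookup (ws j) l))
        at-i : lookup image′ i ≡ f xs
        at-i = trans (lookup∘tabulate (λ l → f (λ j → lookup (ws j) l)) i)
                     (f-cong (λ j → insertAt-lookup (vs j) i (xs j)))
        off-i : ∀ l → lookup image′ (punchIn i l) ≡ lookup image l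
        off-i l = trans (lookup∘tabulate (λ l → f (λ j → lookup (ws j) l)) (punchIn i l))
                    (trans (f-cong (λ j → insertAt-punchIn (vs j) i (xs j) l))
                           (sym (lookup∘tabulate (λ l → f (λ j → lookup (vs j) l)) l)))

    deleted-subuniverse : Subuniverse R → Subuniverse deleted
    deleted-subuniverse SU =
      (restrict (proj₁ (nonempty SU)) , restrict-∈ (proj₂ (nonempty SU))) ,
      deleted-preserved (u2-congruent _⋀_) (⋀-closed SU) ,
      deleted-preserved (u2-congruent opM) (M-closed SU) ,
      deleted-preserved (u1-congruent opM') (M'-closed SU) ,
      deleted-preserved (u2-congruent opI) (I-closed SU) ,
      deleted-preserved (u1-congruent opH) (H-closed SU) ,
      deleted-preserved (u3-congruent opN0) (N0-closed SU) ,
      deleted-preserved (u3-congruent opS) (S-closed SU) ,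
      deleted-preserved (u4-congruent opNd) (Nd-closed SU) ,
      deleted-preserved (u4-congruent opP) (P-closed SU)

  AgreesOff : ∀ {m} → Fin m → Tuple m → Tuple m → Set
  AgreesOff i t s = ∀ l → l ≢ i → lookup t l ≡ lookup s l

  NearMisses : ∀ {m} → Relation m → Tuple m → Set
  NearMisses R s = ∀ i → ∃ λ t → t ∈R R × AgreesOff i t s

  near-misses : ∀ {m} {R : Relation (suc m)} → Subuniverse R →
                ∀ {k} (f : (Fin k → Elem) → Elem) →
                (∀ m′ → m′ ≤ m → (S : Relation m′) → Subuniverse S → Preserves f S) →
                (rs : Fin k → Tuple (suc m)) → (∀ j → rs j ∈R R) →
                NearMisses R (tabulate (λ l → f (λ j → lookup (rs j) l)))
  near-misses {m} {R} SU f f-pres rs rs∈R i =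
    insertAt v i (proj₁ v-extends) , proj₂ v-extends , ≗-off (insertAt v i (proj₁ v-extends)) s i agrees
    where
      open Deletion R i
      s : Tuple (suc m)
      s = tabulate (λ l → f (λ j → lookup (rs j) l))
      v : Tuple m
      v = tabulate (λ l → f (λ j → lookup (restrict (rs j)) l))
      v-extends : Extends v
      v-extends = deleted-sound
        (f-pres m ≤-refl deleted (deleted-subuniverse SU) (λ j → restrict (rs j)) (λ j → restrict-∈ (rs∈R j)))
      agrees : ∀ l → lookup (insertAt v i (proj₁ v-extends)) (punchIn i l) ≡ lookup s (punchIn i l)
      agrees l = begin
        lookup (insertAt v i (proj₁ v-extends)) (punchIn i l)
          ≡⟨ insertAt-punchIn v i _ l ⟩
        lookup v l
          ≡⟨ lookup∘tabulate _ l ⟩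
        f (λ j → lookup (restrict (rs j)) l)
          ≡⟨ lookup∘tabulate-under f (λ j l′ → lookup (rs j) (punchIn i l′)) l ⟩
        f (λ j → lookup (rs j) (punchIn i l))
          ≡⟨ lookup∘tabulate (λ l → f (λ j → lookup (rs j) l)) (punchIn i l) ⟨
        lookup s (punchIn i l) ∎
        where open ≡-Reasoning

  -- Recovering s from its near misses

  module NearMiss (std : Standing) {k} {R : Relation (suc (suc (suc k)))} (SU : Subuniverse R)
                  {s : Tuple (suc (suc (suc k)))} (near : NearMisses R s) where

    open Closure R

    Coord : Set
    Coord = Fin (suc (suc (suc k)))

    t : Coord → Tuple (suc (suc (suc k)))
    t i = proj₁ (near i)

    t-∈ : ∀ i → t i ∈R R
    t-∈ i = proj₁ (proj₂ (near i))

    t-agrees : ∀ i → AgreesOff i (t i) s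
    t-agrees i = proj₂ (proj₂ (near i))

    unsynchronized⇒∈ : ∀ {r} → r ∈R R → ∀ a b → st (lookup r a) ≢ st (lookup r b) → s ∈R R
    unsynchronized⇒∈ {r} r∈R a b a≁b =
      ∈-pointwise (u4 opP) (P-closed SU) (r ∷ w ∷ t b ∷ t a ∷ []) (r∈R ∷ w∈R ∷ t-∈ b ∷ t-∈ a ∷ []) coordinate
      where
        open Constant SU
        constant : Constant (st (lookup r a))
        constant = constant-reachable (Standing.reachFrom1 std _) constant-one
        w = proj₁ constant
        w∈R = proj₁ (proj₂ constant)
        w-st = proj₂ (proj₂ constant)
        coordinate : ∀ l → opP (lookup r l) (lookup w l) (lookup (t b) l) (lookup (t a) l) ≡ lookup s l
        coordinate l with eqS (st (lookup r l)) (st (lookup w l)) in e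
        ... | true  = t-agrees b l λ { refl → a≁b (sym (trans (eqS-sound e) (w-st b))) }
        ... | false = t-agrees a l λ { refl → contradiction (trans (sym e) (eqS-complete (sym (w-st a)))) λ () }

    module Synced (synced : ∀ {r} → r ∈R R → Synchronized r) where

      st-s : ∀ l l′ → st (lookup s l) ≡ st (lookup s l′)
      st-s l l′ with c , c≢l , c≢l′ ← avoid₂ l l′ =
        trans (cong st (sym (t-agrees c l (c≢l ∘ sym))))
              (trans (synced (t-∈ c) l l′) (cong st (t-agrees c l′ (c≢l′ ∘ sym))))

      st-t : ∀ i l → st (lookup (t i) l) ≡ st (lookup s l)
      st-t i l with c , c≢i ← avoid₁ i =
        trans (synced (t-∈ i) l c) (trans (cong st (t-agrees i c c≢i)) (st-s c l))

      steered⇒∈ : ∀ {u} → u ∈R R → ∀ {p q} → p ≢ q →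
                  Steers (lookup u p) (lookup s p) → Steers (lookup u q) (lookup s q) → s ∈R R
      steered⇒∈ {u} u∈R {p} {q} p≢q at-p at-q with c , c≢p , c≢q ← avoid₂ p q =
        ∈-pointwise (u4 opNd) (Nd-closed SU) (u ∷ t p ∷ t q ∷ t c ∷ []) (u∈R ∷ t-∈ p ∷ t-∈ q ∷ t-∈ c ∷ [])
                    coordinate
        where
          coordinate : ∀ l → opNd (lookup u l) (lookup (t p) l) (lookup (t q) l) (lookup (t c) l) ≡ lookup s l
          coordinate l with l ≟ p
          ... | yes refl =
            trans (cong₂ (opNd (lookup u l) (lookup (t l) l)) (t-agrees q l p≢q) (t-agrees c l (c≢p ∘ sym)))
                  (nd-first (lookup u l) (lookup (t l) l) (lookup s l) at-p (st-t l l))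
          ... | no l≢p with l ≟ q
          ...   | yes refl =
            trans (cong₂ (λ x z → opNd (lookup u l) x (lookup (t l) l) z)
                         (t-agrees p l (p≢q ∘ sym)) (t-agrees c l (c≢q ∘ sym)))
                  (nd-second (lookup u l) (lookup (t l) l) (lookup s l) at-q (st-t l l))
          ...   | no l≢q with l ≟ c
          ...     | yes refl =
            trans (cong₂ (λ x y → opNd (lookup u l) x y (lookup (t l) l)) (t-agrees p l l≢p) (t-agrees q l l≢q))
                  (nd-third (lookup u l) (lookup (t l) l) (lookup s l) (st-t l l))
          ...     | no l≢c =
            trans (cong₂ (λ x y → opNd (lookup u l) x y (lookup (t c) l)) (t-agrees p l l≢p) (t-agrees q l l≢q))
                  (trans (cong (opNd (lookup u l) (lookup s l) (lookup s l)) (t-agrees c l l≢c))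
                         (nd-third (lookup u l) (lookup s l) (lookup s l) refl))

      module TwoDots {r} (r∈R : r ∈R R) {a b} (a≢b : a ≢ b)
                     (a∈D : isD (lookup r a) ≡ true) (b∈D : isD (lookup r b) ≡ true) where

        Irr : Tuple (suc (suc (suc k)))
        Irr = tabulate (λ l → opI (lookup r l) (lookup r l))

        Irr-∈ : Irr ∈R R
        Irr-∈ = app₂-∈ opI (I-closed SU) r∈R r∈R

        HIrr : Tuple (suc (suc (suc k)))
        HIrr = tabulate (λ l → opH (lookup Irr l))

        HIrr-∈ : HIrr ∈R R
        HIrr-∈ = H-closed SU (λ _ → Irr) (λ _ → Irr-∈)

        HIrr-∉D : ∀ l → isD (lookup HIrr l) ≡ false
        HIrr-∉D l = trans (cong isD (lookup∘tabulate (λ l → opH (lookup Irr l)) l)) (isD-opH (lookup Irr l))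

        two-X⇒∈ : ∀ {p q} → p ≢ q → isX (lookup s p) ≡ true → isX (lookup s q) ≡ true → s ∈R R
        two-X⇒∈ {p} {q} p≢q p∈X q∈X =
          steered⇒∈ HIrr-∈ p≢q (cross-steers (HIrr-∉D p) p∈X) (cross-steers (HIrr-∉D q) q∈X)

        no-X⇒∈ : (∀ l → isX (lookup s l) ≡ false) → s ∈R R
        no-X⇒∈ ∉X = steered⇒∈ r∈R a≢b (dot-steers a∈D (∉X a)) (dot-steers b∈D (∉X b))

        D-and-X⇒∈ : ∀ {p q} → p ≢ q → isD (lookup s p) ≡ true → isX (lookup s q) ≡ true → s ∈R R
        D-and-X⇒∈ {p} {q} p≢q p∈D q∈X with c , c≢p , c≢q ← avoid₂ p q =
          steered⇒∈ (t-∈ c) p≢q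
            (subst (λ x → Steers x (lookup s p)) (sym (t-agrees c p (c≢p ∘ sym)))
                   (dot-steers p∈D (D⇒¬X (lookup s p) p∈D)))
            (subst (λ x → Steers x (lookup s q)) (sym (t-agrees c q (c≢q ∘ sym)))
                   (cross-steers (X⇒¬D (lookup s q) q∈X) q∈X))

        dot-off : ∀ q → ∃ λ b′ → b′ ≢ q × isD (lookup r b′) ≡ true
        dot-off q with a ≟ q
        ... | yes refl = b , a≢b ∘ sym , b∈D
        ... | no a≢q   = a , a≢q , a∈D

        -- u is ⟨s₁,•⟩ at b′, where (1,R,s₁) is the first instruction, and has content × at q.
        lone-X⇒∈ : ∀ {q} → isX (lookup s q) ≡ true → (∀ l → l ≢ q → isX (lookup s l) ≡ false) →
                   (∀ l → l ≢ q → isD (lookup s l) ≡ false) → s ∈R R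
        lone-X⇒∈ {q} q∈X ∉X ∉D with dot-off q
        ... | b′ , b′≢q , b′∈D with avoid₂ b′ q
        ...   | c , c≢b′ , c≢q =
          steered⇒∈ u-∈ b′≢q (dot-steers (cong isD u-at-b′) (∉X b′ b′≢q)) (cross-steers u-at-q∉D q∈X)
          where
            y : Tuple (suc (suc (suc k)))
            y = tabulate (λ l → opI (lookup HIrr l) (lookup (t c) l))
            u : Tuple (suc (suc (suc k)))
            u = tabulate (λ l → opM (lookup y l) (lookup Irr l))
            u-∈ : u ∈R R
            u-∈ = app₂-∈ opM (M-closed SU) (app₂-∈ opI (I-closed SU) HIrr-∈ (t-∈ c)) Irr-∈
            lookup-u : ∀ l → l ≢ c →
                       lookup u l ≡ opM (opI (lookup HIrr l) (lookup s l)) (opI (lookup r l) (lookup r l))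
            lookup-u l l≢c = trans (lookup∘tabulate (λ l → opM (lookup y l) (lookup Irr l)) l)
              (cong₂ opM (trans (lookup∘tabulate (λ l → opI (lookup HIrr l) (lookup (t c) l)) l)
                                (cong (opI (lookup HIrr l)) (t-agrees c l l≢c)))
                         (lookup∘tabulate (λ l → opI (lookup r l) (lookup r l)) l))
            first = Standing.firstInc std
            s-b′∈C : isC (lookup s b′) ≡ true
            s-b′∈C rewrite ∉D b′ b′≢q | ∉X b′ b′≢q = refl
            u-at-b′ : lookup u b′ ≡ (proj₁ (proj₂ first) , dot)
            u-at-b′ = trans (lookup-u b′ (c≢b′ ∘ sym))
              (trans (cong₂ opM (opI-C (lookup HIrr b′) (lookup s b′) (HIrr-∉D b′) s-b′∈C)
                                (opI-D (lookup r b′) (lookup r b′) b′∈D))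
                     (opM-first (proj₂ (proj₂ first))))
            Irq = opI (lookup r q) (lookup r q)
            u-at-q∉D : isD (lookup u q) ≡ false
            u-at-q∉D = cross⇒¬D (lookup u q) (trans (cong content (trans (lookup-u q (c≢q ∘ sym))
              (cong (λ x → opM x Irq) (opI-X (lookup HIrr q) (lookup s q) (HIrr-∉D q) (X⇒¬C (lookup s q) q∈X)))))
              (M-crossˡ one (st Irq) (content Irq)))

        two-dots⇒∈ : s ∈R R
        two-dots⇒∈ with any? (λ q → isX (lookup s q) Bool.≟ true)
        ... | no ∄X = no-X⇒∈ (λ l → Bool.¬-not (λ l∈X → ∄X (l , l∈X)))
        ... | yes (q , q∈X) with any? (λ p → ¬? (p ≟ q) ×-dec (isX (lookup s p) Bool.≟ true))
        ...   | yes (p , p≢q , p∈X) = two-X⇒∈ p≢q p∈X q∈X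
        ...   | no ∄X′ with any? (λ p → ¬? (p ≟ q) ×-dec (isD (lookup s p) Bool.≟ true))
        ...     | yes (p , p≢q , p∈D) = D-and-X⇒∈ p≢q p∈D q∈X
        ...     | no ∄D′ = lone-X⇒∈ q∈X (λ l l≢q → Bool.¬-not (λ l∈X → ∄X′ (l , l≢q , l∈X)))
                                        (λ l l≢q → Bool.¬-not (λ l∈D → ∄D′ (l , l≢q , l∈D)))

      module OneDot (one-D : ∀ {r} → r ∈R R → AtMostOneD r) where

        s-one-D : ∀ {d l} → isD (lookup s d) ≡ true → isD (lookup s l) ≡ true → d ≡ l
        s-one-D {d} {l} d∈D l∈D with c , c≢d , c≢l ← avoid₂ d l =
          one-D (t-∈ c) d l (trans (cong isD (t-agrees c d (c≢d ∘ sym))) d∈D)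
                            (trans (cong isD (t-agrees c l (c≢l ∘ sym))) l∈D)

        halting-tuple⇒∈ : ∀ {η d} → η ∈R R → lookup η d ≡ (zero , dot) →
                          (∀ l → l ≢ d → lookup η l ≡ (zero , zer)) →
                          (∀ l → l ≢ d → isD (lookup s l) ≡ false) → s ∈R R
        halting-tuple⇒∈ {η} {d} η∈R η-d η-off s-off with b , b≢d ← avoid₁ d =
          ∈-pointwise (u3 opN0) (N0-closed SU) (η ∷ t b ∷ t d ∷ []) (η∈R ∷ t-∈ b ∷ t-∈ d ∷ []) coordinate
          where
            coordinate : ∀ l → opN0 (lookup η l) (lookup (t b) l) (lookup (t d) l) ≡ lookup s l
            coordinate l with l ≟ d
            ... | yes refl =
              trans (cong (λ x → opN0 x (lookup (t b) l) (lookup (t l) l)) η-d)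
                    (trans (opN0-dot (lookup (t b) l) (lookup (t l) l) (trans (st-t b l) (sym (st-t l l))))
                           (t-agrees b l (b≢d ∘ sym)))
            ... | no l≢d =
              trans (cong (λ x → opN0 x (lookup (t b) l) (lookup (t d) l)) (η-off l l≢d))
                    (trans (opN0-zer (lookup (t b) l) (lookup (t d) l)
                                     (trans (cong isD (t-agrees d l l≢d)) (s-off l l≢d))
                                     (trans (st-t b l) (sym (st-t d l))))
                           (t-agrees d l l≢d))

        module _ {r} (r∈R : r ∈R R) (r-halting : ∀ l → lookup r l ≡ (zero , zer) ⊎ lookup r l ≡ (zero , dot))
                 {d} (s-d∈D : isD (lookup s d) ≡ true) where
          open Split SU d
          open Realized

          Hr : Tuple (suc (suc (suc k)))
          Hr = tabulate (λ l → opH (lookup r l))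

          Hr-∈ : Hr ∈R R
          Hr-∈ = H-closed SU (λ _ → r) (λ _ → r∈R)

          Hr-zer : ∀ l → lookup Hr l ≡ (zero , zer)
          Hr-zer l = trans (lookup∘tabulate (λ l → opH (lookup r l)) l) (opH-halting (r-halting l))

          b : Coord
          b = proj₁ (avoid₁ d)

          tb-d∈D : isD (lookup (t b) d) ≡ true
          tb-d∈D = trans (cong isD (t-agrees b d (proj₂ (avoid₁ d) ∘ sym))) s-d∈D

          tb-off∉D : ∀ l → l ≢ d → isD (lookup (t b) l) ≡ false
          tb-off∉D l l≢d = Bool.¬-not (λ l∈D → l≢d (sym (one-D (t-∈ b) d l tb-d∈D l∈D)))

          dot-realized : Realized (one , dot)
          dot-realized = record
            { shade    = one , zer
            ; shadowed = zer-shadow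
            ; split-∈  = ∈-pointwise (u2 opI) (I-closed SU) (t b ∷ Hr ∷ []) (t-∈ b ∷ Hr-∈ ∷ []) coordinate
            }
            where
              coordinate : ∀ l → opI (lookup (t b) l) (lookup Hr l) ≡ lookup (split (one , dot) (one , zer)) l
              coordinate l with l ≟ d
              ... | yes refl = trans (opI-D (lookup (t b) l) (lookup Hr l) tb-d∈D) (sym (split-at _ _))
              ... | no l≢d   = trans (opI-C (lookup (t b) l) (lookup Hr l) (tb-off∉D l l≢d) (cong isC (Hr-zer l)))
                                     (sym (split-off _ _ l≢d))

          zer-realized : Realized (one , zer)
          zer-realized = record
            { shade    = one , zer
            ; shadowed = zer-shadow
            ; split-∈  = ∈-pointwise (u2 opI) (I-closed SU) (Hr ∷ Hr ∷ []) (Hr-∈ ∷ Hr-∈ ∷ []) coordinate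
            }
            where
              coordinate : ∀ l → opI (lookup Hr l) (lookup Hr l) ≡ lookup (split (one , zer) (one , zer)) l
              coordinate l = trans (opI-C (lookup Hr l) (lookup Hr l) (cong isD (Hr-zer l)) (cong isC (Hr-zer l)))
                                   (sym (trans (lookup-split _ _ l) (Bool.if-eta ⌊ l ≟ d ⌋)))

          halting-split-∈ : split (zero , dot) (zero , zer) ∈R R
          halting-split-∈ = subst (λ y → split (zero , dot) y ∈R R) (shadow-of-dot (shadowed realized))
                                  (split-∈ realized)
            where realized = generated⇒realized dot-realized zer-realized (Standing.genHalting std)

        halting⇒∈ : Halting R → s ∈R R
        halting⇒∈ (r , r∈R , r-halting , r-not-zer) with ¬All⇒∃ r-halting r-not-zer
        ... | a , r-a with any? (λ d → isD (lookup s d) Bool.≟ true)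
        ...   | no ∄D = halting-tuple⇒∈ r∈R r-a r-off (λ l _ → Bool.¬-not (λ l∈D → ∄D (l , l∈D)))
          where
            r-off : ∀ l → l ≢ a → lookup r l ≡ (zero , zer)
            r-off l l≢a = [ (λ e → e) , (λ e → contradiction (one-D r∈R l a (cong isD e) (cong isD r-a)) l≢a) ]′
                          (lookup⁺ r-halting l)
        ...   | yes (d , d∈D) =
          halting-tuple⇒∈ (halting-split-∈ r∈R (lookup⁺ r-halting) d∈D) (Split.split-at SU d _ _)
                          (λ l → Split.split-off SU d _ _)
                          (λ l l≢d → Bool.¬-not (λ l∈D → l≢d (sym (s-one-D d∈D l∈D))))

    near-miss⇒∈ : ¬ Computational R ⊎ Halting R → s ∈R R
    near-miss⇒∈ hyp with R s Bool.≟ true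
    ... | yes s∈R = s∈R
    ... | no s∉R  = ⊥-elim ([ (λ ¬comp → ¬comp (λ r r∈R → synced r∈R , one-D r∈R)) ,
                              (λ halt → s∉R (halting⇒∈ halt)) ]′ hyp)
      where
        synced : ∀ {r} → r ∈R R → Synchronized r
        synced {r} r∈R a b with st (lookup r a) ≟ st (lookup r b)
        ... | yes a∼b = a∼b
        ... | no a≁b  = contradiction (unsynchronized⇒∈ r∈R a b a≁b) s∉R
        open Synced synced
        one-D : ∀ {r} → r ∈R R → AtMostOneD r
        one-D r∈R a b a∈D b∈D with a ≟ b
        ... | yes a≡b = a≡b
        ... | no a≢b  = contradiction (TwoDots.two-dots⇒∈ r∈R a≢b a∈D b∈D) s∉R
        open OneDot one-D

theorem8p3 : ∀ {n : ℕ} (𝓜 : Minsky n) → Algebra.Standing 𝓜 →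
    ∀ (m : ℕ) → 3 ≤ m → (R : Algebra.Relation 𝓜 m) → Algebra.Subuniverse 𝓜 R →
    (¬ Algebra.Computational 𝓜 R ⊎ Algebra.Halting 𝓜 R) →
    Algebra.RelLE⊨ 𝓜 (m ∸ 1) R
theorem8p3 𝓜 std (suc (suc (suc _))) (s≤s (s≤s (s≤s _))) R SU hyp _ f f-pres rs rs∈R =
  NearMiss.near-miss⇒∈ 𝓜 std SU (near-misses 𝓜 SU f f-pres rs rs∈R) hyp
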